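{- There is a constant $C > 0$ such that every finite, simple, connected graph $G$ on $n$ vertices that is gap-vertex-labelable satisfies $\chi_V^{g}(G) \le C n^2$; that is, $\chi_V^{g}(G) \in O(n^2)$.
   Context: All graphs are finite, simple and connected. For $k \in \mathbb{N}$ and $[k] = \{1, \ldots, k\}$, a gap-$[k]$-vertex-labelling of $G$ is a pair $(\pi, c_\pi)$ where $\pi : V(G) \to [k]$ and $c_\pi : V(G) \to \{0, 1, \ldots, k\}$ is a proper vertex colouring of $G$ such that for every $v \in V(G)$: if $d(v) \ge 2$ then $c_\pi(v) = \max_{u \in N(v)} \pi(u) - \min_{u \in N(v)} \pi(u)$, and if $d(v) = 1$ then $c_\pi(v) = \pi(u)$ where $u$ is the unique neighbour of $v$. $G$ is gap-vertex-labelable if it admits a gap-$[k]$-vertex-labelling for some $k \in \mathbb{N}$. The vertex-gap number $\chi_V^{g}(G)$ is the least $k$ for which $G$ admits a gap-$[k]$-vertex-labelling. -}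

module Defs where

open import Data.Nat using (ℕ; zero; suc; _+_; _*_; _∸_; _≤_; _<_; _⊔_; _⊓_)
open import Data.Fin using (Fin)
open import Data.Bool using (Bool; true; false; T)
open import Data.List using (List; []; _∷_; [_]; foldr; map; filterᵇ; length; allFin)
open import Data.Product using (Σ; _×_)
open import Data.Unit using (⊤)
open import Relation.Binary.PropositionalEquality using (_≡_; _≢_)
open import Relation.Nullary using (¬_)

record Graph (n : ℕ) : Set where
  field
    adj    : Fin n → Fin n → Bool
    sym    : ∀ u v → adj u v ≡ adj v u
    irrefl : ∀ v → adj v v ≡ false
open Graph public

data Walk {n : ℕ} (G : Graph n) : Fin n → Fin n → Set where
  here : ∀ {u} → Walk G u u
  step : ∀ {u w v} → adj G u w ≡ true → Walk G w v → Walk G u v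

Connected : {n : ℕ} → Graph n → Set
Connected {n} G = ∀ (u v : Fin n) → Walk G u v

neighbours : {n : ℕ} → Graph n → Fin n → List (Fin n)
neighbours {n} G v = filterᵇ (adj G v) (allFin n)

degree : {n : ℕ} → Graph n → Fin n → ℕ
degree G v = length (neighbours G v)

-- maximum / minimum of a list of naturals (only used on nonempty lists)
maxL : List ℕ → ℕ
maxL = foldr _⊔_ 0

minL : List ℕ → ℕ
minL []       = 0
minL (x ∷ xs) = foldr _⊓_ x xs

GapCondition : {n : ℕ} → Graph n → (Fin n → ℕ) → (Fin n → ℕ) → Fin n → Set
GapCondition G π c v with neighbours G v
... | []          = ⊤
... | u ∷ []      = c v ≡ π u
... | u ∷ w ∷ us  = c v ≡ maxL (map π (u ∷ w ∷ us)) ∸ minL (map π (u ∷ w ∷ us))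

record GapLabelling {n : ℕ} (G : Graph n) (k : ℕ) : Set where
  field
    π        : Fin n → ℕ
    c        : Fin n → ℕ
    π-range  : ∀ v → 1 ≤ π v × π v ≤ k
    c-range  : ∀ v → c v ≤ k
    proper   : ∀ u v → adj G u v ≡ true → c u ≢ c v
    gap      : ∀ v → GapCondition G π c v

GapVertexLabelable : {n : ℕ} → Graph n → Set
GapVertexLabelable G = Σ ℕ (λ k → GapLabelling G k)

IsVertexGapNumber : {n : ℕ} → Graph n → ℕ → Set
IsVertexGapNumber G k = GapLabelling G k × (∀ k' → k' < k → ¬ GapLabelling G k')

module Submission where

-- A gap-labelling π can be compressed by a relabelling f that is strictly
-- increasing on the labels used.  Every colour is a width f(hi) − f(lo) of the
-- range of labels around a vertex (lo = 0 at degree one), so only the widths of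
-- adjacent vertices must be kept apart.  Choose f(a) greedily for the labels a
-- in increasing order: if two widths with larger top a were to coincide, f(a)
-- would be determined by values already fixed, so that value is forbidden.
-- There is at most one such constraint per ordered pair of vertices and there
-- are at most n labels, so every new label is at most n + n².

open import Defs hiding (sym)
open import Data.Bool using (true; T)
open import Data.Fin using (Fin)
open import Data.List using (List; []; _∷_; map; length; filter; allFin; cartesianProductWith)
open import Data.List.Membership.Propositional using (_∈_; _∉_)
open import Data.List.Membership.Propositional.Properties
  using (∈-map⁺; ∈-filter⁺; ∈-allFin; ∈-cartesianProductWith⁺)
open import Data.List.Properties
  using (length-map; length-filter; filter-some; filter-notAll; length-++; length-tabulate; map-∘)
open import Data.List.Relation.Binary.Subset.Propositional using (_⊆_)
import Data.List.Relation.Binary.Subset.Propositional.Properties as ⊆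
open import Data.List.Relation.Unary.Any as Any using (here; there)
open import Data.Nat using (ℕ; zero; suc; _+_; _*_; _∸_; _⊔_; _⊓_; _≤_; _<_; z≤n; s≤s; _≤?_; _≟_)
open import Data.Nat.Properties
open import Data.List.Membership.DecPropositional _≟_ using (_∈?_)
open import Data.Product using (Σ; ∃-syntax; _×_; _,_; proj₁; proj₂)
open import Data.Sum as Sum using (_⊎_; inj₁; inj₂; [_,_])
open import Data.Unit using (tt)
open import Function using (id; _∘_; _⇔_; Equivalence; mk⇔)
open import Relation.Binary using (_Preserves_⟶_; tri<; tri≈; tri>)
open import Relation.Binary.PropositionalEquality
  using (_≡_; _≢_; refl; sym; trans; cong; cong₂; subst; ≢-sym; module ≡-Reasoning)
open import Relation.Nullary using (¬_; yes; no; ¬?; contradiction)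
open import Relation.Nullary.Decidable using (T?)
open import Relation.Unary using (Decidable)

freshFrom : ∀ y (L : List ℕ) → ∃[ z ] y ≤ z × z ≤ y + length L × z ∉ L
freshFrom y L = search (length L) y L ≤-refl
  where
  search : ∀ k y (L : List ℕ) → length L ≤ k → ∃[ z ] y ≤ z × z ≤ y + length L × z ∉ L
  search k y L _ with y ∈? L
  search k       y L       _       | no y∉L = y , ≤-refl , m≤m+n y (length L) , y∉L
  search zero    y (_ ∷ _) ()      | yes _
  search (suc k) y L       |L|≤1+k | yes y∈L = lift (search k (suc y) L⁻ (≤-pred (≤-trans shorter |L|≤1+k)))
    where
    L⁻ : List ℕ
    L⁻ = filter (λ w → ¬? (w ≟ y)) L
    shorter : length L⁻ < length L
    shorter = filter-notAll (λ w → ¬? (w ≟ y)) L (Any.map (λ y≡w w≢y → w≢y (sym y≡w)) y∈L)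
    lift : ∃[ z ] suc y ≤ z × z ≤ suc y + length L⁻ × z ∉ L⁻ → ∃[ z ] y ≤ z × z ≤ y + length L × z ∉ L
    lift (z , y<z , z≤ , z∉L⁻) =
      z , <⇒≤ y<z , ≤-trans z≤ (≤-trans (≤-reflexive (sym (+-suc y _))) (+-monoʳ-≤ y shorter))
      , λ z∈L → z∉L⁻ (∈-filter⁺ (λ w → ¬? (w ≟ y)) z∈L (λ z≡y → <⇒≢ y<z (sym z≡y)))

module _ {A : Set} {P Q R : A → Set} (P? : Decidable P) (Q? : Decidable Q) (R? : Decidable R) where

  length-filter-disjoint-∪ : (∀ {a} → P a → ¬ Q a) → (∀ {a} → R a ⇔ (P a ⊎ Q a)) →
    ∀ xs → length (filter P? xs) + length (filter Q? xs) ≡ length (filter R? xs)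
  length-filter-disjoint-∪ P∩Q=∅ R⇔P∪Q [] = refl
  length-filter-disjoint-∪ P∩Q=∅ R⇔P∪Q (a ∷ xs)
    with ih ← length-filter-disjoint-∪ P∩Q=∅ R⇔P∪Q xs | P? a | Q? a | R? a
  ... | yes p | yes q | _     = contradiction q (P∩Q=∅ p)
  ... | yes p | no _  | yes _ = cong suc ih
  ... | no _  | yes _ | yes _ = trans (+-suc _ _) (cong suc ih)
  ... | no _  | no _  | no _  = ih
  ... | yes p | no _  | no ¬r = contradiction (Equivalence.from R⇔P∪Q (inj₁ p)) ¬r
  ... | no _  | yes q | no ¬r = contradiction (Equivalence.from R⇔P∪Q (inj₂ q)) ¬r
  ... | no ¬p | no ¬q | yes r = contradiction (Equivalence.to R⇔P∪Q r) [ ¬p , ¬q ]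

length-filter-≤-suc : ∀ {A : Set} (κ : A → ℕ) x xs →
  length (filter (λ a → κ a ≤? x) xs) + length (filter (λ a → κ a ≟ suc x) xs)
    ≡ length (filter (λ a → κ a ≤? suc x) xs)
length-filter-≤-suc κ x = length-filter-disjoint-∪ (λ a → κ a ≤? x) (λ a → κ a ≟ suc x) (λ a → κ a ≤? suc x)
  (λ κa≤x κa≡1+x → n≮n x (subst (_≤ x) κa≡1+x κa≤x))
  (mk⇔ (Sum.map ≤-pred id ∘ m≤n⇒m<n∨m≡n) [ m≤n⇒m≤1+n , ≤-reflexive ])

length-filter-≤-mono : ∀ {A : Set} (κ : A → ℕ) x xs →
  length (filter (λ a → κ a ≤? x) xs) ≤ length (filter (λ a → κ a ≤? suc x) xs)
length-filter-≤-mono κ x xs = ≤-trans (m≤m+n _ _) (≤-reflexive (length-filter-≤-suc κ x xs))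

maxL-∈ : ∀ a l → maxL (a ∷ l) ∈ a ∷ l
maxL-∈ a []      = here (⊔-identityʳ a)
maxL-∈ a (b ∷ l) with ⊔-sel a (maxL (b ∷ l))
... | inj₁ a⊔m≡a = here a⊔m≡a
... | inj₂ a⊔m≡m = there (subst (_∈ b ∷ l) (sym a⊔m≡m) (maxL-∈ b l))

minL-∈ : ∀ a l → minL (a ∷ l) ∈ a ∷ l
minL-∈ a []      = here refl
minL-∈ a (b ∷ l) with ⊓-sel b (minL (a ∷ l))
... | inj₁ b⊓m≡b = there (here b⊓m≡b)
... | inj₂ b⊓m≡m with minL-∈ a l
...   | here m≡a   = here (trans b⊓m≡m m≡a)
...   | there m∈l = there (there (subst (_∈ l) (sym b⊓m≡m) m∈l))

≤-maxL : ∀ {x l} → x ∈ l → x ≤ maxL l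
≤-maxL {l = a ∷ l} (here refl) = m≤m⊔n a (maxL l)
≤-maxL {l = a ∷ l} (there x∈l) = ≤-trans (≤-maxL x∈l) (m≤n⊔m a (maxL l))

module _ {g : ℕ → ℕ} (g-mono : g Preserves _≤_ ⟶ _≤_) where

  maxL-map : g 0 ≡ 0 → ∀ l → maxL (map g l) ≡ g (maxL l)
  maxL-map g0≡0 []      = sym g0≡0
  maxL-map g0≡0 (a ∷ l) = trans (cong (g a ⊔_) (maxL-map g0≡0 l)) (sym (mono-≤-distrib-⊔ g-mono a (maxL l)))

  minL-map : ∀ a l → minL (map g (a ∷ l)) ≡ g (minL (a ∷ l))
  minL-map a []      = refl
  minL-map a (b ∷ l) = trans (cong (g b ⊓_) (minL-map a l)) (sym (mono-≤-distrib-⊓ g-mono b (minL (a ∷ l))))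

Span : Set
Span = ℕ × ℕ

width : (ℕ → ℕ) → Span → ℕ
width h (a , b) = h a ∸ h b

_∈₀_ : ℕ → List ℕ → Set
x ∈₀ xs = x ≡ 0 ⊎ x ∈ xs

SpanIn : List ℕ → Span → Set
SpanIn xs (a , b) = b ≤ a × a ∈₀ xs × b ∈₀ xs

-- GapCondition asks for c v ≡ width id (extremes (labels around v)); a vertex
-- of degree one gets the span (π u , 0), an isolated vertex the junk span (0 , 0).
extremes : List ℕ → Span
extremes []          = 0 , 0
extremes (a ∷ [])    = a , 0
extremes (a ∷ b ∷ l) = maxL (a ∷ b ∷ l) , minL (a ∷ b ∷ l)

extremes-spanIn : ∀ l → SpanIn l (extremes l)
extremes-spanIn []          = z≤n , inj₁ refl , inj₁ refl
extremes-spanIn (a ∷ [])    = z≤n , inj₂ (here refl) , inj₁ refl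
extremes-spanIn (a ∷ b ∷ l) = ≤-maxL (minL-∈ a (b ∷ l)) , inj₂ (maxL-∈ a (b ∷ l)) , inj₂ (minL-∈ a (b ∷ l))

spanIn-⊆ : ∀ {xs ys} → xs ⊆ ys → ∀ s → SpanIn xs s → SpanIn ys s
spanIn-⊆ xs⊆ys (a , b) (b≤a , a∈₀xs , b∈₀xs) = b≤a , Sum.map id xs⊆ys a∈₀xs , Sum.map id xs⊆ys b∈₀xs

width-extremes-map : ∀ {g} → g Preserves _≤_ ⟶ _≤_ → g 0 ≡ 0 → ∀ l →
  width id (extremes (map g l)) ≡ width g (extremes l)
width-extremes-map     g-mono g0≡0 []          = cong₂ _∸_ (sym g0≡0) (sym g0≡0)
width-extremes-map {g} g-mono g0≡0 (a ∷ [])    = cong (g a ∸_) (sym g0≡0)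
width-extremes-map     g-mono g0≡0 (a ∷ b ∷ l) = cong₂ _∸_ (maxL-map g-mono g0≡0 (a ∷ b ∷ l)) (minL-map g-mono a (b ∷ l))

-- The constraint (s , t) has top a = proj₁ s; when the other three ends lie
-- below a, f a ≡ obstruction f (s , t) says exactly width f s ≡ width f t.
-- stage x is f as it stands after the points 1 … x have been processed.
module Greedy (S : List ℕ) (cs : List (Span × Span)) where

  top : Span × Span → ℕ
  top ((a , _) , _) = a

  obstruction : (ℕ → ℕ) → Span × Span → ℕ
  obstruction h ((_ , b) , t) = h b + width h t

  forbidden : (ℕ → ℕ) → ℕ → List ℕ
  forbidden h a = map (obstruction h) (filter (λ c → top c ≟ a) cs)

  next : ℕ → (ℕ → ℕ) → ℕ
  next x h with suc x ∈? S
  ... | yes _ = proj₁ (freshFrom (suc (h x)) (forbidden h (suc x)))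
  ... | no  _ = h x

  stage : ℕ → ℕ → ℕ
  stage zero    _ = 0
  stage (suc x) y with y ≤? x
  ... | yes _ = stage x y
  ... | no  _ = next x (stage x)

  f : ℕ → ℕ
  f y = stage y y

  stage-stable : ∀ {x y} → y ≤ x → stage x y ≡ f y
  stage-stable {zero}  z≤n = refl
  stage-stable {suc x} {y} y≤1+x with m≤n⇒m<n∨m≡n y≤1+x
  ... | inj₂ refl = refl
  ... | inj₁ (s≤s y≤x) with y ≤? x
  ...   | yes _   = stage-stable y≤x
  ...   | no y≰x = contradiction y≤x y≰x

  f-suc : ∀ x → f (suc x) ≡ next x (stage x)
  f-suc x with suc x ≤? x
  ... | yes x<x = contradiction x<x (n≮n x)
  ... | no _    = refl

  f-step-∈ : ∀ {x} → suc x ∈ S →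
    f x < f (suc x) × f (suc x) ≤ suc (f x) + length (forbidden (stage x) (suc x))
                    × f (suc x) ∉ forbidden (stage x) (suc x)
  f-step-∈ {x} x∈S rewrite f-suc x with suc x ∈? S
  ... | yes _  = proj₂ (freshFrom (suc (f x)) (forbidden (stage x) (suc x)))
  ... | no x∉S = contradiction x∈S x∉S

  f-step-∉ : ∀ {x} → suc x ∉ S → f (suc x) ≡ f x
  f-step-∉ {x} x∉S rewrite f-suc x with suc x ∈? S
  ... | yes x∈S = contradiction x∈S x∉S
  ... | no _    = refl

  f-suc-mono : ∀ x → f x ≤ f (suc x)
  f-suc-mono x with suc x ∈? S
  ... | yes x∈S = <⇒≤ (proj₁ (f-step-∈ x∈S))
  ... | no x∉S  = ≤-reflexive (sym (f-step-∉ x∉S))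

  f-mono : f Preserves _≤_ ⟶ _≤_
  f-mono {a} {zero} z≤n = ≤-refl
  f-mono {a} {suc b} a≤1+b with m≤n⇒m<n∨m≡n a≤1+b
  ... | inj₁ (s≤s a≤b) = ≤-trans (f-mono a≤b) (f-suc-mono b)
  ... | inj₂ refl      = ≤-refl

  f-strict : ∀ {a b} → a < b → b ∈ S → f a < f b
  f-strict {a} {suc b} (s≤s a≤b) b∈S = ≤-<-trans (f-mono a≤b) (proj₁ (f-step-∈ b∈S))

  f-reflects-≤ : ∀ {a b} → b ∈₀ S → f b ≤ f a → b ≤ a
  f-reflects-≤ (inj₁ refl) _    = z≤n
  f-reflects-≤ (inj₂ b∈S)  fb≤fa = ≮⇒≥ (λ a<b → <⇒≱ (f-strict a<b b∈S) fb≤fa)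

  f-injective : ∀ {a b} → a ∈₀ S → b ∈₀ S → f a ≡ f b → a ≡ b
  f-injective a∈₀S b∈₀S fa≡fb =
    ≤-antisym (f-reflects-≤ a∈₀S (≤-reflexive fa≡fb)) (f-reflects-≤ b∈₀S (≤-reflexive (sym fa≡fb)))

  f-avoids : ∀ {s t} → (s , t) ∈ cs → proj₁ s ∈ S → proj₂ s < proj₁ s → proj₂ t ≤ proj₁ t → proj₁ t < proj₁ s →
    f (proj₁ s) ≢ obstruction f (s , t)
  f-avoids {suc x , b} {a′ , b′} st∈cs x∈S (s≤s b≤x) b′≤a′ (s≤s a′≤x) fx≡ =
    proj₂ (proj₂ (f-step-∈ x∈S)) (subst (_∈ forbidden (stage x) (suc x)) obstruction≡ listed)
    where
    listed : obstruction (stage x) ((suc x , b) , (a′ , b′)) ∈ forbidden (stage x) (suc x)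
    listed = ∈-map⁺ (obstruction (stage x)) (∈-filter⁺ (λ c → top c ≟ suc x) st∈cs refl)
    obstruction≡ : obstruction (stage x) ((suc x , b) , (a′ , b′)) ≡ f (suc x)
    obstruction≡ = trans (cong₂ _+_ (stage-stable b≤x) (cong₂ _∸_ (stage-stable a′≤x) (stage-stable (≤-trans b′≤a′ a′≤x))))
                         (sym fx≡)

  #labels≤ #constraints≤ budget : ℕ → ℕ
  #labels≤ x      = length (filter (_≤? x) S)
  #constraints≤ x = length (filter (λ c → top c ≤? x) cs)
  budget x        = #labels≤ x + #constraints≤ x

  f-budget : ∀ x → f x ≤ budget x
  f-budget zero = z≤n
  f-budget (suc x) with suc x ∈? S
  ... | yes x∈S = begin
    f (suc x)                                                   ≤⟨ proj₁ (proj₂ (f-step-∈ x∈S)) ⟩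
    suc (f x) + length (forbidden (stage x) (suc x))            ≡⟨ cong (suc (f x) +_) (length-map (obstruction (stage x)) (filter (λ c → top c ≟ suc x) cs)) ⟩
    suc (f x) + #constraints≡                                   ≤⟨ +-monoˡ-≤ _ (s≤s (f-budget x)) ⟩
    suc (#labels≤ x + #constraints≤ x) + #constraints≡          ≡⟨ +-assoc (suc (#labels≤ x)) _ _ ⟩
    suc (#labels≤ x) + (#constraints≤ x + #constraints≡)        ≤⟨ +-monoˡ-≤ _ (m<m+n (#labels≤ x) (filter-some (_≟ suc x) (Any.map sym x∈S))) ⟩
    (#labels≤ x + #labels≡) + (#constraints≤ x + #constraints≡) ≡⟨ cong₂ _+_ (length-filter-≤-suc id x S) (length-filter-≤-suc top x cs) ⟩
    budget (suc x)                                              ∎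
    where
    open ≤-Reasoning
    #labels≡ #constraints≡ : ℕ
    #labels≡      = length (filter (_≟ suc x) S)
    #constraints≡ = length (filter (λ c → top c ≟ suc x) cs)
  ... | no x∉S  = begin
    f (suc x)  ≡⟨ f-step-∉ x∉S ⟩
    f x        ≤⟨ f-budget x ⟩
    budget x   ≤⟨ +-mono-≤ (length-filter-≤-mono id x S) (length-filter-≤-mono top x cs) ⟩
    budget (suc x) ∎
    where open ≤-Reasoning

  f-bound : ∀ x → f x ≤ length S + length cs
  f-bound x = ≤-trans (f-budget x) (+-mono-≤ (length-filter _ S) (length-filter _ cs))

  ∈₀∧pos⇒∈ : ∀ {a} → a ∈₀ S → 0 < a → a ∈ S
  ∈₀∧pos⇒∈ (inj₁ refl) ()
  ∈₀∧pos⇒∈ (inj₂ a∈S)  _ = a∈S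

  -- Either s has width 0, and then t is forced to width 0 as well, or the
  -- pair (s , t) is one of the constraints forbidding the value of f a.
  width-separated-< : ∀ {s t} → SpanIn S s → SpanIn S t → (s , t) ∈ cs → proj₁ t < proj₁ s →
    width id s ≢ width id t → width f s ≢ width f t
  width-separated-< {a , b} {a′ , b′} (b≤a , a∈₀S , _) (b′≤a′ , a′∈₀S , _) st∈cs a′<a widths≢ fwidths≡
    with m≤n⇒m<n∨m≡n b≤a
  ... | inj₁ b<a = f-avoids st∈cs (∈₀∧pos⇒∈ a∈₀S (≤-<-trans z≤n a′<a)) b<a b′≤a′ a′<a
                     (trans (sym (m+[n∸m]≡n (f-mono b≤a))) (cong (f b +_) fwidths≡))
  ... | inj₂ refl = widths≢ (trans (n∸n≡0 a) (sym (trans (cong (_∸ b′) a′≡b′) (n∸n≡0 b′))))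
    where
    a′≡b′ : a′ ≡ b′
    a′≡b′ = ≤-antisym (f-reflects-≤ a′∈₀S (m∸n≡0⇒m≤n (trans (sym fwidths≡) (n∸n≡0 (f a))))) b′≤a′

  width-separated : ∀ {s t} → SpanIn S s → SpanIn S t → (s , t) ∈ cs → (t , s) ∈ cs →
    width id s ≢ width id t → width f s ≢ width f t
  width-separated {a , b} {a′ , b′} s∈S t∈S st∈cs ts∈cs widths≢ with <-cmp a a′
  ... | tri< a<a′ _ _ = ≢-sym (width-separated-< t∈S s∈S ts∈cs a<a′ (≢-sym widths≢))
  ... | tri> _ _ a′<a = width-separated-< s∈S t∈S st∈cs a′<a widths≢
  ... | tri≈ _ refl _ = λ fwidths≡ →
    widths≢ (cong (a ∸_) (f-injective (proj₂ (proj₂ s∈S)) (proj₂ (proj₂ t∈S))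
      (∸-cancelˡ-≡ (f-mono (proj₁ s∈S)) (f-mono (proj₁ t∈S)) fwidths≡)))

module _ {n : ℕ} (G : Graph n) where

  ∈-neighbours : ∀ {u v} → adj G u v ≡ true → v ∈ neighbours G u
  ∈-neighbours {u} {v} uv = ∈-filter⁺ (T? ∘ adj G u) (∈-allFin v) (subst T (sym uv) tt)

  gapCondition-intro : ∀ {π c : Fin n → ℕ} v → c v ≡ width id (extremes (map π (neighbours G v))) → GapCondition G π c v
  gapCondition-intro v c≡ with neighbours G v
  ... | []        = tt
  ... | _ ∷ []    = c≡
  ... | _ ∷ _ ∷ _ = c≡

  gapCondition-elim : ∀ {π c : Fin n → ℕ} {u v} → GapCondition G π c v → u ∈ neighbours G v →
    c v ≡ width id (extremes (map π (neighbours G v)))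
  gapCondition-elim {v = v} gap u∈N with neighbours G v
  gapCondition-elim gap ()  | []
  gapCondition-elim gap _   | _ ∷ []    = gap
  gapCondition-elim gap _   | _ ∷ _ ∷ _ = gap

length-cartesianProductWith : ∀ {A B C : Set} (g : A → B → C) xs ys →
  length (cartesianProductWith g xs ys) ≡ length xs * length ys
length-cartesianProductWith g []       ys = refl
length-cartesianProductWith g (x ∷ xs) ys =
  trans (length-++ (map (g x) ys)) (cong₂ _+_ (length-map (g x) ys) (length-cartesianProductWith g xs ys))

length-allFin : ∀ n → length (allFin n) ≡ n
length-allFin n = length-tabulate {n = n} id

module Relabelling {n : ℕ} (G : Graph n) {k : ℕ} (L : GapLabelling G k) where
  open GapLabelling L

  labels : List ℕ
  labels = map π (allFin n)

  span : Fin n → Span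
  span v = extremes (map π (neighbours G v))

  conflicts : List (Span × Span)
  conflicts = cartesianProductWith (λ u v → span u , span v) (allFin n) (allFin n)

  open Greedy labels conflicts

  span-spanIn : ∀ v → SpanIn labels (span v)
  span-spanIn v = spanIn-⊆ (⊆.map⁺ π (λ {w} _ → ∈-allFin w)) (span v) (extremes-spanIn (map π (neighbours G v)))

  conflict-∈ : ∀ u v → (span u , span v) ∈ conflicts
  conflict-∈ u v = ∈-cartesianProductWith⁺ (λ u v → span u , span v) (∈-allFin u) (∈-allFin v)

  c≡width : ∀ {u v} → adj G u v ≡ true → c u ≡ width id (span u)
  c≡width uv = gapCondition-elim G (gap _) (∈-neighbours G uv)

  f≤n+n*n : ∀ x → f x ≤ n + n * n
  f≤n+n*n x = subst (f x ≤_) (cong₂ _+_ length-labels length-conflicts) (f-bound x)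
    where
    length-labels : length labels ≡ n
    length-labels = trans (length-map π (allFin n)) (length-allFin n)
    length-conflicts : length conflicts ≡ n * n
    length-conflicts = trans (length-cartesianProductWith _ (allFin n) (allFin n))
                             (cong₂ _*_ (length-allFin n) (length-allFin n))

  proper-relabelled : ∀ u v → adj G u v ≡ true → width f (span u) ≢ width f (span v)
  proper-relabelled u v uv = width-separated (span-spanIn u) (span-spanIn v) (conflict-∈ u v) (conflict-∈ v u)
    (λ widths≡ → proper u v uv (trans (c≡width uv) (trans widths≡ (sym (c≡width (trans (Graph.sym G v u) uv))))))

  gap-relabelled : ∀ v → GapCondition G (f ∘ π) (width f ∘ span) v
  gap-relabelled v = gapCondition-intro G v (sym (begin
    width id (extremes (map (f ∘ π) N))     ≡⟨ cong (width id ∘ extremes) (map-∘ N) ⟩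
    width id (extremes (map f (map π N)))   ≡⟨ width-extremes-map f-mono refl (map π N) ⟩
    width f (span v)                        ∎))
    where
    open ≡-Reasoning
    N : List (Fin n)
    N = neighbours G v

  relabelled : GapLabelling G (n + n * n)
  relabelled = record
    { π       = f ∘ π
    ; c       = width f ∘ span
    ; π-range = λ v → f-strict (proj₁ (π-range v)) (∈-map⁺ π (∈-allFin v)) , f≤n+n*n (π v)
    ; c-range = λ v → ≤-trans (m∸n≤m (f (proj₁ (span v))) (f (proj₂ (span v)))) (f≤n+n*n (proj₁ (span v)))
    ; proper  = proper-relabelled
    ; gap     = gap-relabelled
    }

n≤n*n : ∀ n → n ≤ n * n
n≤n*n zero    = z≤n
n≤n*n (suc m) = m≤m*n (suc m) (suc m)

vertexGapNumber-≤ : ∀ {n} {G : Graph n} {k k′} → IsVertexGapNumber G k → GapLabelling G k′ → k ≤ k′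
vertexGapNumber-≤ (_ , minimal) L = ≮⇒≥ (λ k′<k → minimal _ k′<k L)

theorem2 : Σ ℕ (λ C → 0 < C × (∀ (n : ℕ) (G : Graph n) → Connected G → GapVertexLabelable G → ∀ (k : ℕ) → IsVertexGapNumber G k → k ≤ C * (n * n)))
theorem2 = 2 , s≤s z≤n , λ n G _ (_ , L) k isGapNumber → begin
  k               ≤⟨ vertexGapNumber-≤ isGapNumber (Relabelling.relabelled G L) ⟩
  n + n * n       ≤⟨ +-monoˡ-≤ (n * n) (n≤n*n n) ⟩
  n * n + n * n   ≡⟨ cong (n * n +_) (sym (+-identityʳ (n * n))) ⟩
  2 * (n * n)     ∎
  where open ≤-Reasoning
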